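{- For any prime $p\geq 5$ and any integer $k$ with $2\leq k\leq p-2$, there does not exist a balanced array in $\mathbf{A}_p(\mathbb{Z}_{p^2})_{S(k)^*}$.
   Context: $\mathbb{Z}_m=\mathbb{Z}/m\mathbb{Z}$. $T_p=\mathbb{Z}_p\times\mathbb{Z}_p$ and $\mathbf{A}_p(\mathbb{Z}_{p^2})$ is the set of functions $\mathbf{a}:T_p\to\mathbb{Z}_{p^2}$. For $k\ge 2$, $S(k)^*=\{(i_1,i_2)\in\mathbb{Z}^2;0\le i_1,i_2\le k-1\}\setminus\{(0,0)\}$, and $\mathbf{A}_p(\mathbb{Z}_{p^2})_{S(k)^*}$ is the set of $\mathbf{a}\in\mathbf{A}_p(\mathbb{Z}_{p^2})$ such that $\sum_{\mathbf{i}\in S(k)^*}\mathbf{a}_{\mathbf{i}+\mathbf{k}}=0$ in $\mathbb{Z}_{p^2}$ for every $\mathbf{k}\in T_p$ (indices modulo $p$). An array is balanced if all its $p^2$ values are distinct, i.e. its set of values is all of $\mathbb{Z}_{p^2}$. -}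

module Defs where

open import Data.Nat using (ℕ; zero; suc; _+_; _*_; _≡ᵇ_; NonZero)
open import Data.Nat.DivMod using (_mod_)
open import Data.Fin using (Fin; toℕ)
open import Data.Nat.ListAction using (sum)
open import Data.Nat.Divisibility using (_∣_)
open import Data.List using (List; map; upTo; concatMap; filterᵇ)
open import Data.Bool using (Bool; _∧_; not)
open import Data.Product using (_×_; _,_)
open import Function.Definitions using (Injective)
open import Relation.Binary.PropositionalEquality using (_≡_)

-- T_p = ℤ_p × ℤ_p, elements of ℤ_p represented by Fin p.
-- An array a : T_p → ℤ_{p²}; ℤ_{p²} represented by Fin (p * p).
Array : (p : ℕ) → Set
Array p = Fin p × Fin p → Fin (p * p)

S* : ℕ → List (ℕ × ℕ)
S* k = filterᵇ (λ { (i₁ , i₂) → not ((i₁ ≡ᵇ 0) ∧ (i₂ ≡ᵇ 0)) })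
               (concatMap (λ i₁ → map (λ i₂ → (i₁ , i₂)) (upTo k)) (upTo k))

shift : (p : ℕ) .{{_ : NonZero p}} → ℕ × ℕ → Fin p × Fin p → Fin p × Fin p
shift p (i₁ , i₂) (x , y) = ((i₁ + toℕ x) mod p , (i₂ + toℕ y) mod p)

-- a ∈ A_p(ℤ_{p²})_{S(k)*}: for every 𝐤 ∈ T_p, Σ_{𝐢 ∈ S(k)*} a_{𝐢+𝐤} = 0 in ℤ_{p²}
-- (sum computed in ℕ from the canonical representatives; = 0 mod p² means p² divides it)
InAS : (p k : ℕ) .{{_ : NonZero p}} → Array p → Set
InAS p k a = ∀ (𝐤 : Fin p × Fin p) →
  (p * p) ∣ sum (map (λ 𝐢 → toℕ (a (shift p 𝐢 𝐤))) (S* k))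

Balanced : (p : ℕ) → Array p → Set
Balanced p a = Injective _≡_ _≡_ a

-- Let L be the operator f ↦ Σ_{𝐢 ∈ S(k)*} f(· + 𝐢) on functions ℤ_p² → ℤ_p. Translations commute and
-- have order p, so in characteristic p the Frobenius identity gives L^p = |S(k)*| = (k − 1)(k + 1),
-- a unit mod p because 2 ≤ k ≤ p − 2. An array a in A_p(ℤ_{p²})_{S(k)*} satisfies L a ≡ 0 (mod p),
-- hence a ≡ |S(k)*|⁻¹ L^{p−1} (L a) ≡ 0 (mod p): every value is a multiple of p, so a takes at most
-- p of the p² values and is not balanced.
module Submission where

open import Defs
open import Algebra.Bundles using (Semiring)
open import Data.Nat using (ℕ; NonZero)
open import Data.Nat.Primality using (Prime; euclidsLemma; prime⇒nonTrivial)
open import Relation.Binary.PropositionalEquality as ≡ using (_≡_; cong; subst)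

module BinomialCoefficients where

  open import Data.Empty using (⊥-elim)
  open import Data.Nat using (zero; suc; _*_; _∸_; _<_; _≤_; _!; nonTrivial⇒≢1)
  open import Data.Nat.Combinatorics using (_C_; nCk≡n!/k![n-k]!; k![n∸k]!∣n!)
  open import Data.Nat.Divisibility using (_∣_; _∤_; m∣m*n; ∣1⇒≡1; >⇒∤)
  open import Data.Nat.DivMod using (m/n*n≡m)
  open import Data.Nat.Properties using (n<1+n; <-trans; <⇒≤; ∸-monoʳ-<; _!*_!≢0)
  open import Data.Sum using (inj₁; inj₂; [_,_]′)

  nCk*k![n∸k]!≡n! : ∀ {n k} → k ≤ n → (n C k) * (k ! * (n ∸ k) !) ≡ n !
  nCk*k![n∸k]!≡n! {n} {k} k≤n = ≡.trans (cong (_* (k ! * (n ∸ k) !)) (nCk≡n!/k![n-k]! k≤n))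
    (m/n*n≡m {{k !* (n ∸ k) !≢0}} (k![n∸k]!∣n! k≤n))

  prime∤factorial : ∀ {p} → Prime p → ∀ {m} → m < p → p ∤ m !
  prime∤factorial pp {zero} _ p∣1 = nonTrivial⇒≢1 {{prime⇒nonTrivial pp}} (∣1⇒≡1 p∣1)
  prime∤factorial pp {suc m} m<p p∣m! with euclidsLemma (suc m) (m !) pp p∣m!
  ... | inj₁ p∣1+m = >⇒∤ m<p p∣1+m
  ... | inj₂ p∣m!  = prime∤factorial pp (<-trans (n<1+n m) m<p) p∣m!

  prime∣binomial : ∀ {p k} → Prime p → 0 < k → k < p → p ∣ p C k
  prime∣binomial {suc q} {k} pp 0<k k<p
    with euclidsLemma (suc q C k) (k ! * (suc q ∸ k) !) pp
           (subst (suc q ∣_) (≡.sym (nCk*k![n∸k]!≡n! (<⇒≤ k<p))) (m∣m*n (q !)))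
  ... | inj₁ p∣pCk = p∣pCk
  ... | inj₂ p∣k![p∸k]! = ⊥-elim
    ([ prime∤factorial pp k<p , prime∤factorial pp (∸-monoʳ-< 0<k (<⇒≤ k<p)) ]′
     (euclidsLemma (k !) ((suc q ∸ k) !) pp p∣k![p∸k]!))

module Frobenius {c ℓ} (S : Semiring c ℓ) where

  open Semiring S hiding (zero)
  open import Algebra.Properties.Semiring.Exp S
  open import Algebra.Properties.Semiring.Mult S
  open import Algebra.Properties.Monoid.Sum +-monoid using (sum; sum-init-last; sum-cong-≋; sum-replicate-zero)
  import Algebra.Properties.Semiring.Binomial
  open import Data.Fin using (Fin; zero; suc; toℕ; fromℕ)
  open import Data.Fin.Properties using (toℕ-inject₁; toℕ-fromℕ; toℕ<n)
  open import Data.Nat as ℕ using (suc; _<_; z<s; s<s)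
  open import Data.Nat.Combinatorics using (nCn≡1)
  open import Data.Nat.Divisibility using (_∣_; divides)
  open import Data.Nat.Properties using (n∸n≡0)
  open import Data.Vec.Functional using (Vector; init; last)
  open BinomialCoefficients using (prime∣binomial)
  open import Relation.Binary.Reasoning.Setoid setoid

  ∣⇒×≈0# : ∀ {p n} → p × 1# ≈ 0# → p ∣ n → ∀ z → n × z ≈ 0#
  ∣⇒×≈0# {p} p×1≈0 (divides q ≡.refl) z = begin
    (q ℕ.* p) × z             ≈⟨ ×-congʳ (q ℕ.* p) (*-identityˡ z) ⟨
    (q ℕ.* p) × (1# * z)      ≈⟨ ×-assoc-* (q ℕ.* p) 1# z ⟨
    ((q ℕ.* p) × 1#) * z      ≈⟨ *-congʳ (×1-homo-* q p) ⟩
    ((q × 1#) * (p × 1#)) * z ≈⟨ *-congʳ (*-congˡ p×1≈0) ⟩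
    ((q × 1#) * 0#) * z       ≈⟨ *-congʳ (zeroʳ (q × 1#)) ⟩
    0# * z                    ≈⟨ zeroˡ z ⟩
    0#                        ∎

  frobenius : ∀ {p} → Prime p → p × 1# ≈ 0# → ∀ {x y} → x * y ≈ y * x → (x + y) ^ p ≈ x ^ p + y ^ p
  frobenius {suc q} pp p×1≈0 {x} {y} x*y≈y*x = begin
    (x + y) ^ p                              ≈⟨ theorem x*y≈y*x p ⟩
    binomialTerm p zero + sum inner
      ≈⟨ +-cong (trans (+-identityʳ _) (*-identityˡ _)) (sum-init-last inner) ⟩
    y ^ p + (sum (init inner) + last inner)
      ≈⟨ +-congˡ (+-cong (trans (sum-cong-≋ middle) (sum-replicate-zero q)) final) ⟩
    y ^ p + (0# + x ^ p)                     ≈⟨ trans (+-congˡ (+-identityˡ _)) (+-comm _ _) ⟩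
    x ^ p + y ^ p                            ∎
    where
    p = suc q
    open Algebra.Properties.Semiring.Binomial S x y using (theorem; binomialTerm)

    inner : Vector Carrier p
    inner i = binomialTerm p (suc i)

    middle : ∀ i → init inner i ≈ 0#
    middle i = ∣⇒×≈0# p×1≈0
      (prime∣binomial pp z<s (s<s (subst (_< q) (≡.sym (toℕ-inject₁ i)) (toℕ<n i)))) _

    lastTerm : ∀ (i : Fin (suc p)) → toℕ i ≡ p → binomialTerm p i ≈ x ^ p
    lastTerm i i≡p rewrite i≡p | nCn≡1 p | n∸n≡0 p = trans (+-identityʳ _) (*-identityʳ _)

    final : last inner ≈ x ^ p
    final = lastTerm (suc (fromℕ q)) (cong suc (toℕ-fromℕ q))

module Endomorphisms (p : ℕ) .{{_ : NonZero p}} (A : Set) where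

  open import Data.List using (List; []; _∷_; map; length)
  open import Data.Nat using (_+_; _*_; zero; suc; pred)
  open import Data.Nat.Divisibility using (_∣_; m∣m*n; m%n≡0⇒n∣m; n∣m⇒m%n≡0)
  open import Data.Nat.DivMod using (_%_; %-distribˡ-+; m*n%n≡0)
  open import Data.Nat.ListAction using (sum)
  open import Data.Nat.Properties using (+-comm; +-assoc; +-identityʳ; suc-pred; +-commutativeSemigroup)
  open import Algebra.Properties.CommutativeSemigroup +-commutativeSemigroup using (interchange)
  open import Data.Product using (_,_)
  open import Function.Endo.Propositional A using (^-homo) renaming (_^_ to _^ᶠ_)

  infix 4 _≡ₚ_
  _≡ₚ_ : ℕ → ℕ → Set
  m ≡ₚ n = m % p ≡ n % p

  0%p≡0 : 0 % p ≡ 0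
  0%p≡0 = m*n%n≡0 0 p

  ∣⇒≡ₚ0 : ∀ {n} → p ∣ n → n ≡ₚ 0
  ∣⇒≡ₚ0 p∣n = ≡.trans (n∣m⇒m%n≡0 _ p p∣n) (≡.sym 0%p≡0)

  ≡ₚ0⇒∣ : ∀ {n} → n ≡ₚ 0 → p ∣ n
  ≡ₚ0⇒∣ n≡0 = m%n≡0⇒n∣m _ p (≡.trans n≡0 0%p≡0)

  +-cong-≡ₚ : ∀ {m m′ n n′} → m ≡ₚ m′ → n ≡ₚ n′ → m + n ≡ₚ m′ + n′
  +-cong-≡ₚ {m} {m′} {n} {n′} m≡m′ n≡n′ = begin
    (m + n) % p             ≡⟨ %-distribˡ-+ m n p ⟩
    (m % p + n % p) % p     ≡⟨ ≡.cong₂ (λ u v → (u + v) % p) m≡m′ n≡n′ ⟩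
    (m′ % p + n′ % p) % p   ≡⟨ %-distribˡ-+ m′ n′ p ⟨
    (m′ + n′) % p           ∎
    where open ≡.≡-Reasoning

  -- Additive maps on ℤ_p-valued functions on A, with ℤ_p represented by ℕ up to ≡ₚ.
  record Endo : Set where
    field
      apply      : (A → ℕ) → A → ℕ
      apply-cong : ∀ {f g} → (∀ x → f x ≡ₚ g x) → ∀ x → apply f x ≡ₚ apply g x
      apply-+    : ∀ f g x → apply (λ y → f y + g y) x ≡ₚ apply f x + apply g x
      apply-0    : ∀ x → apply (λ _ → 0) x ≡ₚ 0
  open Endo public

  infix 4 _≈_
  _≈_ : Endo → Endo → Set
  O ≈ Q = ∀ f x → apply O f x ≡ₚ apply Q f x

  0# : Endo
  0# = record
    { apply = λ _ _ → 0 ; apply-cong = λ _ _ → ≡.refl ; apply-+ = λ _ _ _ → ≡.refl ; apply-0 = λ _ → ≡.refl }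

  1# : Endo
  1# = record
    { apply = λ f → f ; apply-cong = λ f≡g → f≡g ; apply-+ = λ _ _ _ → ≡.refl ; apply-0 = λ _ → ≡.refl }

  infixl 6 _⊕_
  infixl 7 _⊛_

  _⊕_ : Endo → Endo → Endo
  O ⊕ Q = record
    { apply      = λ f x → apply O f x + apply Q f x
    ; apply-cong = λ f≡g x → +-cong-≡ₚ (apply-cong O f≡g x) (apply-cong Q f≡g x)
    ; apply-+    = λ f g x → ≡.trans (+-cong-≡ₚ (apply-+ O f g x) (apply-+ Q f g x))
                                     (≡.cong (_% p) (interchange (apply O f x) (apply O g x) (apply Q f x) (apply Q g x)))
    ; apply-0    = λ x → +-cong-≡ₚ (apply-0 O x) (apply-0 Q x)
    }

  _⊛_ : Endo → Endo → Endo
  O ⊛ Q = record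
    { apply      = λ f → apply O (apply Q f)
    ; apply-cong = λ f≡g → apply-cong O (apply-cong Q f≡g)
    ; apply-+    = λ f g x → ≡.trans (apply-cong O (apply-+ Q f g) x) (apply-+ O (apply Q f) (apply Q g) x)
    ; apply-0    = λ x → ≡.trans (apply-cong O (apply-0 Q) x) (apply-0 O x)
    }

  semiring : Semiring _ _
  semiring = record
    { Carrier = Endo ; _≈_ = _≈_ ; _+_ = _⊕_ ; _*_ = _⊛_ ; 0# = 0# ; 1# = 1#
    ; isSemiring = record
      { isSemiringWithoutAnnihilatingZero = record
        { +-isCommutativeMonoid = record
          { isMonoid = record
            { isSemigroup = record
              { isMagma = record
                { isEquivalence = record
                  { refl  = λ _ _ → ≡.refl
                  ; sym   = λ O≈Q f x → ≡.sym (O≈Q f x)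
                  ; trans = λ O≈Q Q≈R f x → ≡.trans (O≈Q f x) (Q≈R f x) }
                ; ∙-cong = λ O≈O′ Q≈Q′ f x → +-cong-≡ₚ (O≈O′ f x) (Q≈Q′ f x) }
              ; assoc = λ O Q R f x → ≡.cong (_% p) (+-assoc (apply O f x) (apply Q f x) (apply R f x)) }
            ; identity = (λ _ _ _ → ≡.refl) , (λ O f x → ≡.cong (_% p) (+-identityʳ (apply O f x))) }
          ; comm = λ O Q f x → ≡.cong (_% p) (+-comm (apply O f x) (apply Q f x)) }
        ; *-cong = λ {O} {_} {_} {Q′} O≈O′ Q≈Q′ f x →
            ≡.trans (apply-cong O (Q≈Q′ f) x) (O≈O′ (apply Q′ f) x)
        ; *-assoc = λ _ _ _ _ _ → ≡.refl
        ; *-identity = (λ _ _ _ → ≡.refl) , (λ _ _ _ → ≡.refl)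
        ; distrib = (λ O Q R f → apply-+ O (apply Q f) (apply R f)) , (λ _ _ _ _ _ → ≡.refl) }
      ; zero = (λ _ _ _ → ≡.refl) , (λ O _ → apply-0 O) } }

  open import Algebra.Definitions.RawSemiring (Semiring.rawSemiring semiring) using (_^_; _×_)
  open import Algebra.Properties.Semiring.Exp semiring using (^-homo-*; ^-congʳ)
  open Frobenius semiring using (frobenius)

  apply-× : ∀ n O f x → apply (n × O) f x ≡ n * apply O f x
  apply-× zero    O f x = ≡.refl
  apply-× (suc n) O f x = ≡.cong (apply O f x +_) (apply-× n O f x)

  characteristic : p × 1# ≈ 0#
  characteristic f x = ≡.trans (≡.cong (_% p) (apply-× p 1# f x)) (∣⇒≡ₚ0 (m∣m*n (f x)))

  translation : (A → A) → Endo
  translation σ = record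
    { apply = λ f x → f (σ x) ; apply-cong = λ f≡g x → f≡g (σ x)
    ; apply-+ = λ _ _ _ → ≡.refl ; apply-0 = λ _ → ≡.refl }

  apply-translation-^ : ∀ σ n f x → apply (translation σ ^ n) f x ≡ f ((σ ^ᶠ n) x)
  apply-translation-^ σ zero    f x = ≡.refl
  apply-translation-^ σ (suc n) f x = ≡.trans (apply-translation-^ σ n f (σ x)) (≡.cong f σ^n∘σ≡σ∘σ^n)
    where
    σ^n∘σ≡σ∘σ^n : (σ ^ᶠ n) (σ x) ≡ σ ((σ ^ᶠ n) x)
    σ^n∘σ≡σ∘σ^n = ≡.cong-app (≡.trans (≡.sym (^-homo σ n 1)) (≡.cong (σ ^ᶠ_) (+-comm n 1))) x

  module TranslationSums {I : Set} (σ : I → A → A) (σ-comm : ∀ i j x → σ i (σ j x) ≡ σ j (σ i x)) where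

    translationSum : List I → Endo
    translationSum []       = 0#
    translationSum (i ∷ is) = translation (σ i) ⊕ translationSum is

    apply-translationSum : ∀ is f x → apply (translationSum is) f x ≡ sum (map (λ i → f (σ i x)) is)
    apply-translationSum []       f x = ≡.refl
    apply-translationSum (i ∷ is) f x = ≡.cong (f (σ i x) +_) (apply-translationSum is f x)

    translation-translationSum-comm : ∀ i is →
      translation (σ i) ⊛ translationSum is ≈ translationSum is ⊛ translation (σ i)
    translation-translationSum-comm i is f x = ≡.cong (_% p) (commute is)
      where
      commute : ∀ is → apply (translationSum is) f (σ i x) ≡ apply (translationSum is) (λ y → f (σ i y)) x
      commute []        = ≡.refl
      commute (j ∷ js)  = ≡.cong₂ _+_ (≡.cong f (σ-comm j i x)) (commute js)

    translationSum^p≈length×1 : Prime p → (∀ i x → (σ i ^ᶠ p) x ≡ x) →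
      ∀ is → translationSum is ^ p ≈ length is × 1#
    translationSum^p≈length×1 pp σ-order []       = ^-congʳ 0# (≡.sym (suc-pred p))
    translationSum^p≈length×1 pp σ-order (i ∷ is) f x = ≡.trans
      (frobenius pp characteristic (translation-translationSum-comm i is) f x)
      (+-cong-≡ₚ (≡.cong (_% p) (≡.trans (apply-translation-^ (σ i) p f x) (≡.cong f (σ-order i x))))
                 (translationSum^p≈length×1 pp σ-order is f x))

    p∣translationSums⇒p∣length* : Prime p → (∀ i x → (σ i ^ᶠ p) x ≡ x) →
      ∀ is f → (∀ x → p ∣ sum (map (λ i → f (σ i x)) is)) → ∀ x → p ∣ length is * f x
    p∣translationSums⇒p∣length* pp σ-order is f p∣Lf x = ≡ₚ0⇒∣ (begin
      (length is * f x) % p                    ≡⟨ ≡.cong (_% p) (apply-× (length is) 1# f x) ⟨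
      apply (length is × 1#) f x % p           ≡⟨ translationSum^p≈length×1 pp σ-order is f x ⟨
      apply (L ^ p) f x % p                    ≡⟨ L^p≈L^[p-1]*L f x ⟩
      apply (L ^ pred p) (apply L f) x % p     ≡⟨ apply-cong (L ^ pred p) Lf≡ₚ0 x ⟩
      apply (L ^ pred p) (λ _ → 0) x % p       ≡⟨ apply-0 (L ^ pred p) x ⟩
      0 % p                                    ∎)
      where
      open ≡.≡-Reasoning
      L = translationSum is
      L^p≈L^[p-1]*L : L ^ p ≈ L ^ pred p ⊛ L
      L^p≈L^[p-1]*L f x = ≡.trans (^-congʳ L (≡.trans (≡.sym (suc-pred p)) (+-comm 1 (pred p))) f x)
                                  (^-homo-* L (pred p) 1 f x)
      Lf≡ₚ0 : ∀ y → apply L f y ≡ₚ 0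
      Lf≡ₚ0 y = ≡.trans (≡.cong (_% p) (apply-translationSum is f y)) (∣⇒≡ₚ0 (p∣Lf y))

module Shifts (p : ℕ) .{{_ : NonZero p}} where

  open import Data.Fin using (Fin; toℕ)
  open import Data.Fin.Properties using (toℕ-injective; toℕ-fromℕ<; toℕ<n)
  open import Data.Nat using (_+_; _*_; zero; suc)
  open import Data.Nat.DivMod using (_%_; _mod_; %-distribˡ-+; m%n%n≡m%n; [m+kn]%n≡m%n; m<n⇒m%n≡m)
  open import Data.Nat.Properties using (+-assoc; +-comm; *-comm; +-commutativeSemigroup)
  open import Algebra.Properties.CommutativeSemigroup +-commutativeSemigroup using (x∙yz≈y∙xz)
  open import Data.Product using (_×_; _,_)
  open import Function.Endo.Propositional (Fin p × Fin p) using () renaming (_^_ to _^ᶠ_)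
  open ≡.≡-Reasoning

  rotate : ℕ → Fin p → Fin p
  rotate i x = (i + toℕ x) mod p

  [m+n%p]%p≡[m+n]%p : ∀ m n → (m + n % p) % p ≡ (m + n) % p
  [m+n%p]%p≡[m+n]%p m n = begin
    (m + n % p) % p          ≡⟨ %-distribˡ-+ m (n % p) p ⟩
    (m % p + n % p % p) % p  ≡⟨ cong (λ u → (m % p + u) % p) (m%n%n≡m%n n p) ⟩
    (m % p + n % p) % p      ≡⟨ %-distribˡ-+ m n p ⟨
    (m + n) % p              ∎

  rotate-mod : ∀ i m → rotate i (m mod p) ≡ (i + m) mod p
  rotate-mod i m = toℕ-injective (begin
    toℕ (rotate i (m mod p))  ≡⟨ toℕ-fromℕ< _ ⟩
    (i + toℕ (m mod p)) % p   ≡⟨ cong (λ u → (i + u) % p) (toℕ-fromℕ< _) ⟩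
    (i + m % p) % p           ≡⟨ [m+n%p]%p≡[m+n]%p i m ⟩
    (i + m) % p               ≡⟨ toℕ-fromℕ< _ ⟨
    toℕ ((i + m) mod p)       ∎)

  [k*p+x]mod-p≡x : ∀ k x → (k * p + toℕ x) mod p ≡ x
  [k*p+x]mod-p≡x k x = toℕ-injective (begin
    toℕ ((k * p + toℕ x) mod p)  ≡⟨ toℕ-fromℕ< _ ⟩
    (k * p + toℕ x) % p          ≡⟨ cong (_% p) (+-comm (k * p) (toℕ x)) ⟩
    (toℕ x + k * p) % p          ≡⟨ [m+kn]%n≡m%n (toℕ x) k p ⟩
    toℕ x % p                    ≡⟨ m<n⇒m%n≡m (toℕ<n x) ⟩
    toℕ x                        ∎)

  rotate-comm : ∀ i j x → rotate i (rotate j x) ≡ rotate j (rotate i x)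
  rotate-comm i j x = begin
    rotate i (rotate j x)    ≡⟨ rotate-mod i (j + toℕ x) ⟩
    (i + (j + toℕ x)) mod p  ≡⟨ cong (_mod p) (x∙yz≈y∙xz i j (toℕ x)) ⟩
    (j + (i + toℕ x)) mod p  ≡⟨ rotate-mod j (i + toℕ x) ⟨
    rotate j (rotate i x)    ∎

  shift-comm : ∀ 𝐢 𝐣 𝐤 → shift p 𝐢 (shift p 𝐣 𝐤) ≡ shift p 𝐣 (shift p 𝐢 𝐤)
  shift-comm (i₁ , i₂) (j₁ , j₂) (x , y) = ≡.cong₂ _,_ (rotate-comm i₁ j₁ x) (rotate-comm i₂ j₂ y)

  shift-^ : ∀ n i₁ i₂ x y →
    (shift p (i₁ , i₂) ^ᶠ n) (x , y) ≡ ((n * i₁ + toℕ x) mod p , (n * i₂ + toℕ y) mod p)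
  shift-^ zero    i₁ i₂ x y = ≡.sym (≡.cong₂ _,_ ([k*p+x]mod-p≡x 0 x) ([k*p+x]mod-p≡x 0 y))
  shift-^ (suc n) i₁ i₂ x y = begin
    shift p (i₁ , i₂) ((shift p (i₁ , i₂) ^ᶠ n) (x , y))
      ≡⟨ cong (shift p (i₁ , i₂)) (shift-^ n i₁ i₂ x y) ⟩
    (rotate i₁ ((n * i₁ + toℕ x) mod p) , rotate i₂ ((n * i₂ + toℕ y) mod p))
      ≡⟨ ≡.cong₂ _,_ (step i₁ x) (step i₂ y) ⟩
    ((suc n * i₁ + toℕ x) mod p , (suc n * i₂ + toℕ y) mod p) ∎
    where
    step : ∀ i z → rotate i ((n * i + toℕ z) mod p) ≡ (suc n * i + toℕ z) mod p
    step i z = ≡.trans (rotate-mod i (n * i + toℕ z)) (cong (_mod p) (≡.sym (+-assoc i (n * i) (toℕ z))))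

  shift-^-order : ∀ 𝐢 𝐤 → (shift p 𝐢 ^ᶠ p) 𝐤 ≡ 𝐤
  shift-^-order (i₁ , i₂) (x , y) = ≡.trans (shift-^ p i₁ i₂ x y) (≡.cong₂ _,_ (period i₁ x) (period i₂ y))
    where
    period : ∀ i z → (p * i + toℕ z) mod p ≡ z
    period i z = ≡.trans (cong (λ u → (u + toℕ z) mod p) (*-comm p i)) ([k*p+x]mod-p≡x i z)

open import Data.Bool using (Bool; not; _∧_; T; T?)
open import Data.Fin using (Fin; toℕ; fromℕ<)
open import Data.Fin.Properties using (toℕ-injective; toℕ-fromℕ<; toℕ<n; injective⇒≤; *↔×)
open import Data.List using (List; []; _∷_; map; length; applyUpTo; concatMap; _++_)
open import Data.List.Properties using (filter-all; length-map; length-++; length-applyUpTo)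
open import Data.List.Relation.Unary.All using (All)
open import Data.List.Relation.Unary.All.Properties using (map⁺; ++⁺; concat⁺; applyUpTo⁺₁)
open import Data.Nat using (suc; _+_; _*_; _∸_; _<_; _≤_; _≡ᵇ_; s≤s; z≤n; nonTrivial⇒n>1)
open import Data.Nat.Divisibility using (_∣_; _∤_; ∣-trans; m∣m*n; >⇒∤)
open import Data.Nat.DivMod using (_/_; m/n*n≡m; m<n*o⇒m/o<n)
open import Data.Nat.Properties using (*-suc; +-comm; <⇒≱; m<m*n; m≤o∸n⇒m+n≤o; ≤-trans; m≤n+m)
open import Data.Product using (_×_; _,_; Σ)
open import Data.Empty using (⊥-elim)
open import Data.Sum using ([_,_]′)
open import Function using (_∘_; id)
open import Function.Bundles using (Injection)
open import Function.Definitions using (Injective)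
open import Function.Properties.Inverse using (↔⇒↣)
open import Relation.Nullary using (¬_)

length-concatMap-const : ∀ {A B : Set} {n} (f : A → List B) → (∀ x → length (f x) ≡ n) →
                         ∀ xs → length (concatMap f xs) ≡ length xs * n
length-concatMap-const f |f|≡n []       = ≡.refl
length-concatMap-const f |f|≡n (x ∷ xs) =
  ≡.trans (length-++ (f x)) (≡.cong₂ _+_ (|f|≡n x) (length-concatMap-const f |f|≡n xs))

length-S* : ∀ m → length (S* (suc m)) ≡ m * (2 + m)
length-S* m = begin
  length (S* (suc m))                 ≡⟨ cong length (filter-all (T? ∘ nonOrigin) allNonOrigin) ⟩
  length (column₀ ++ concatMap column (applyUpTo suc m))  ≡⟨ length-++ column₀ ⟩
  length column₀ + length (concatMap column (applyUpTo suc m))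
    ≡⟨ ≡.cong₂ _+_ (≡.trans (length-map _ (applyUpTo suc m)) (length-applyUpTo suc m))
                    (≡.trans (length-concatMap-const column |column|≡1+m (applyUpTo suc m))
                             (cong (_* suc m) (length-applyUpTo suc m))) ⟩
  m + m * suc m                       ≡⟨ *-suc m (suc m) ⟨
  m * (2 + m)                         ∎
  where
  open ≡.≡-Reasoning
  nonOrigin : ℕ × ℕ → Bool
  nonOrigin (i₁ , i₂) = not ((i₁ ≡ᵇ 0) ∧ (i₂ ≡ᵇ 0))
  column : ℕ → List (ℕ × ℕ)
  column i₁ = map (i₁ ,_) (applyUpTo id (suc m))
  column₀ : List (ℕ × ℕ)
  column₀ = map (0 ,_) (applyUpTo suc m)
  allNonOrigin : All (T ∘ nonOrigin) (column₀ ++ concatMap column (applyUpTo suc m))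
  allNonOrigin = ++⁺ (map⁺ (applyUpTo⁺₁ suc m _))
                     (concat⁺ (map⁺ (applyUpTo⁺₁ suc m (λ _ → map⁺ (applyUpTo⁺₁ id (suc m) _)))))
  |column|≡1+m : ∀ i₁ → length (column i₁) ≡ suc m
  |column|≡1+m i₁ = ≡.trans (length-map _ (applyUpTo id (suc m))) (length-applyUpTo id (suc m))

prime∤length-S* : ∀ {p k} → Prime p → 2 ≤ k → k ≤ p ∸ 2 → p ∤ length (S* k)
prime∤length-S* {p} {suc (suc m)} pp (s≤s (s≤s z≤n)) k≤p∸2 p∣len =
  [ >⇒∤ (≤-trans (m≤n+m (suc (suc m)) 2) k+1<p) , >⇒∤ k+1<p ]′
  (euclidsLemma (suc m) (2 + suc m) pp (subst (p ∣_) (length-S* (suc m)) p∣len))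
  where
  k+1<p : suc (suc (suc m)) < p
  k+1<p = subst (_≤ p) (+-comm (suc (suc m)) 2)
            (m≤o∸n⇒m+n≤o (suc (suc m)) (nonTrivial⇒n>1 p {{prime⇒nonTrivial pp}}) k≤p∸2)

injective⇒*≤ : ∀ {m n k} {f : Fin m × Fin n → Fin k} → Injective _≡_ _≡_ f → m * n ≤ k
injective⇒*≤ {m} {n} f-injective = injective⇒≤ (λ eq → remQuot-injective (f-injective eq))
  where remQuot-injective = Injection.injective (↔⇒↣ (*↔× {m} {n}))

balanced⇒¬all-multiples : ∀ {p} .{{_ : NonZero p}} → 1 < p → (a : Array p) → Balanced p a →
                           ¬ (∀ 𝐤 → p ∣ toℕ (a 𝐤))
balanced⇒¬all-multiples {p} 1<p a a-injective p∣a = <⇒≱ (m<m*n p p 1<p) (injective⇒*≤ quotient-injective)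
  where
  quotient : Fin p × Fin p → Fin p
  quotient 𝐤 = fromℕ< (m<n*o⇒m/o<n {n = p} {o = p} (toℕ<n (a 𝐤)))

  quotient-injective : Injective _≡_ _≡_ quotient
  quotient-injective {𝐤} {𝐥} eq = a-injective (toℕ-injective (begin
    toℕ (a 𝐤)          ≡⟨ m/n*n≡m (p∣a 𝐤) ⟨
    toℕ (a 𝐤) / p * p
      ≡⟨ cong (_* p) (≡.trans (≡.sym (toℕ-fromℕ< _)) (≡.trans (cong toℕ eq) (toℕ-fromℕ< _))) ⟩
    toℕ (a 𝐥) / p * p  ≡⟨ m/n*n≡m (p∣a 𝐥) ⟩
    toℕ (a 𝐥)          ∎))
    where open ≡.≡-Reasoning

open Endomorphisms using (module TranslationSums)
open Shifts using (shift-comm; shift-^-order)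

proposition5p2 : (p k : ℕ) → Prime p → 5 ≤ p → 2 ≤ k → k ≤ p ∸ 2 →
    .{{_ : NonZero p}} → ¬ (Σ (Array p) λ a → InAS p k a × Balanced p a)
proposition5p2 p k pp _ 2≤k k≤p∸2 (a , a∈AS , a-balanced) =
  balanced⇒¬all-multiples 1<p a a-balanced p∣a
  where
  open TranslationSums p (Fin p × Fin p) (shift p) (shift-comm p) using (p∣translationSums⇒p∣length*)
  1<p : 1 < p
  1<p = nonTrivial⇒n>1 p {{prime⇒nonTrivial pp}}

  p∣length*a : ∀ 𝐤 → p ∣ length (S* k) * toℕ (a 𝐤)
  p∣length*a = p∣translationSums⇒p∣length* pp (shift-^-order p) (S* k) (toℕ ∘ a)
                 (λ 𝐤 → ∣-trans (m∣m*n p) (a∈AS 𝐤))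

  p∣a : ∀ 𝐤 → p ∣ toℕ (a 𝐤)
  p∣a 𝐤 = [ ⊥-elim ∘ prime∤length-S* pp 2≤k k≤p∸2 , id ]′ (euclidsLemma _ _ pp (p∣length*a 𝐤))
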